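{- For integers $1 \le k \le d < n$, $$P(n,d) \le P(n-k,d)\cdot\binom{n}{k}.$$
   Context: A permutation on $\{1,\dots,n\}$ is a sequence listing each element of $\{1,\dots,n\}$ exactly once. The Chebyshev distance between permutations $\sigma,\pi$ is $\max_{i}|\sigma(i)-\pi(i)|$. $P(n,d)$ denotes the maximum cardinality of a set of permutations on $\{1,\dots,n\}$ in which any two distinct permutations have Chebyshev distance at least $d$. -}

module Defs where

open import Data.Nat using (ℕ; _≤_; _⊔_; ∣_-_∣)
open import Data.Fin using (Fin; toℕ)
open import Data.Fin.Permutation using (Permutation′; _⟨$⟩ʳ_)
open import Data.List using (List; foldr; map; length; allFin)
open import Data.List.Relation.Unary.AllPairs using (AllPairs)
open import Data.Product using (_×_; Σ)
open import Relation.Binary.PropositionalEquality using (_≡_)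
open import Relation.Nullary using (¬_)

-- Permutations of {1,…,n} are modelled as bijections of Fin n = {0,…,n-1};
-- the shift by one does not affect differences of values.

chebyshev : {n : ℕ} → Permutation′ n → Permutation′ n → ℕ
chebyshev {n} σ π =
  foldr _⊔_ 0 (map (λ i → ∣ toℕ (σ ⟨$⟩ʳ i) - toℕ (π ⟨$⟩ʳ i) ∣) (allFin n))

Separated : {n : ℕ} → ℕ → Permutation′ n → Permutation′ n → Set
Separated d σ π = (¬ (∀ i → σ ⟨$⟩ʳ i ≡ π ⟨$⟩ʳ i)) × (d ≤ chebyshev σ π)

-- A set of permutations, listed without repetition, with pairwise distance ≥ d.
IsCode : (n d : ℕ) → List (Permutation′ n) → Set
IsCode n d C = AllPairs (Separated d) C

IsP : (n d m : ℕ) → Set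
IsP n d m =
  Σ (List (Permutation′ n)) (λ C → IsCode n d C × length C ≡ m)
  × (∀ (C : List (Permutation′ n)) → IsCode n d C → length C ≤ m)

-- Sort the permutations of a code by the set of positions that σ sends into the top k values
-- {n-k, …, n-1}: there are (n choose k) such sets, since σ is a bijection each has exactly k
-- elements. Fix a class and a representative ρ in it. For σ in the class, σ ∘ ρ⁻¹ maps the
-- bottom n-k values onto themselves, so it restricts to a permutation of {0, …, n-k-1}. Two
-- permutations of the class cannot reach distance ≥ d ≥ k inside the top block, whose values
-- differ by less than k; so their maximal distance is attained at a position ρ sends into the
-- bottom block, where it is preserved by the restriction. Hence each class maps injectively
-- onto a code of permutations of {0, …, n-k-1}, and so has at most P(n-k, d) elements.
module Submission where

open import Defs
open import Data.Nat using (ℕ; _≤_; _<_; _∸_; _*_)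
open import Data.Nat.Combinatorics using (_C_)

open import Data.Bool using (Bool; true; false; if_then_else_)
open import Data.Empty using (⊥-elim)
import Data.Fin as Fin
open import Data.Fin using (Fin; toℕ; _↑ˡ_; _↑ʳ_; splitAt)
open import Data.Fin.Permutation
  using (Permutation′; _⟨$⟩ʳ_; _⟨$⟩ˡ_; permutation; flip; _∘ₚ_; inverseˡ; inverseʳ)
open import Data.Fin.Properties
  using (toℕ-↑ˡ; toℕ-↑ʳ; toℕ<n; ↑ˡ-injective; splitAt⁻¹-↑ˡ; splitAt⁻¹-↑ʳ)
open import Data.Fin.Subset using (Subset; inside; outside; ⊤; ⊥; ∣_∣)
open import Data.Fin.Subset.Properties using (∣⊤∣≡n)
open import Data.List using (List; []; _∷_; [_]; _++_; map; filter; foldr; length; allFin)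
open import Data.List.Properties using (length-map; length-++)
open import Data.List.Membership.Propositional using (_∈_)
open import Data.List.Membership.Propositional.Properties using (∈-allFin; ∈-map⁺; ∈-++⁺ˡ; ∈-++⁺ʳ)
open import Data.List.Relation.Binary.Sublist.Propositional.Properties as Sublist
  using (filter-⊆; length-mono-≤)
open import Data.List.Relation.Unary.All as All using (All; []; _∷_)
import Data.List.Relation.Unary.All.Properties as All
open import Data.List.Relation.Unary.AllPairs using (AllPairs; []; _∷_)
import Data.List.Relation.Unary.AllPairs.Properties as AllPairs
open import Data.List.Relation.Unary.Any using (Any; here; there; satisfied)
import Data.List.Relation.Unary.Any.Properties as Any
open import Data.Nat using (zero; suc; _+_; _⊔_; ∣_-_∣; z≤n)
open import Data.Nat.Combinatorics using (nCk+nC[k+1]≡[n+1]C[k+1])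
open import Data.Nat.Properties
open import Algebra.Properties.CommutativeMonoid.Sum +-0-commutativeMonoid using (sum; sum-permute)
open import Data.Product using (∃; _,_; proj₁; proj₂)
open import Data.Sum using (_⊎_; inj₁; inj₂)
open import Data.Vec using ([]; _∷_; tabulate; lookup) renaming (_++_ to _++ᵛ_)
open import Data.Vec.Properties
  using (lookup∘tabulate; tabulate∘lookup; lookup-++ˡ; lookup-++ʳ; lookup-replicate; ≡-dec)
open import Function using (id; _∘_)
open import Relation.Binary.Definitions using (DecidableEquality)
open import Relation.Binary.PropositionalEquality hiding ([_])
open import Relation.Nullary using (¬_; yes; no)
open import Relation.Unary using (Decidable)
open import Relation.Unary.Properties using (∁?)

module _ {A : Set} {P : A → Set} (P? : Decidable P) where

  length-filter+filter-∁ : ∀ xs → length (filter P? xs) + length (filter (∁? P?) xs) ≡ length xs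
  length-filter+filter-∁ [] = refl
  length-filter+filter-∁ (x ∷ xs) with P? x
  ... | yes _ = cong suc (length-filter+filter-∁ xs)
  ... | no _ = trans (+-suc _ _) (cong suc (length-filter+filter-∁ xs))

module _ {A B : Set} (f : A → B) (_≟_ : DecidableEquality B) where

  fibre : B → List A → List A
  fibre b = filter (λ x → f x ≟ b)

  length-≤-fibres : ∀ {q} (bs : List B) (xs : List A) → All (λ x → f x ∈ bs) xs →
                    (∀ b → length (fibre b xs) ≤ q) → length xs ≤ length bs * q
  length-≤-fibres [] [] _ _ = z≤n
  length-≤-fibres [] (_ ∷ _) (() ∷ _) _
  length-≤-fibres {q} (b ∷ bs) xs keys fibres = begin
      length xs                            ≡⟨ length-filter+filter-∁ (λ x → f x ≟ b) xs ⟨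
      length (fibre b xs) + length rest    ≤⟨ +-mono-≤ (fibres b) rest-bound ⟩
      q + length bs * q                    ∎
    where
      open ≤-Reasoning
      rest : List A
      rest = filter (∁? (λ x → f x ≟ b)) xs
      rest-keys : All (λ x → f x ∈ bs) rest
      rest-keys = All.zipWith (λ { (here fx≡b , fx≢b) → ⊥-elim (fx≢b fx≡b) ; (there fx∈bs , _) → fx∈bs })
                    (All.filter⁺ _ keys , All.all-filter _ xs)
      rest-fibres : ∀ b′ → length (fibre b′ rest) ≤ q
      rest-fibres b′ = ≤-trans (length-mono-≤ (Sublist.filter⁺ _ _ (λ { refl → id }) (filter-⊆ _ xs)))
                               (fibres b′)
      rest-bound : length rest ≤ length bs * q
      rest-bound = length-≤-fibres bs rest rest-keys rest-fibres

module _ {A B : Set} {P : A → Set} (f : (x : A) → P x → B) where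

  mapAll : {xs : List A} → All P xs → List B
  mapAll [] = []
  mapAll {x ∷ _} (px ∷ pxs) = f x px ∷ mapAll pxs

  length-mapAll : {xs : List A} (pxs : All P xs) → length (mapAll pxs) ≡ length xs
  length-mapAll [] = refl
  length-mapAll (_ ∷ pxs) = cong suc (length-mapAll pxs)

  AllPairs-mapAll : {R : A → A → Set} {S : B → B → Set} →
                    (∀ x y (px : P x) (py : P y) → R x y → S (f x px) (f y py)) →
                    {xs : List A} (pxs : All P xs) → AllPairs R xs → AllPairs S (mapAll pxs)
  AllPairs-mapAll f-pres [] [] = []
  AllPairs-mapAll {R} {S} f-pres (px ∷ pxs) (Rx ∷ Rxs) =
    All-mapAll pxs Rx ∷ AllPairs-mapAll f-pres pxs Rxs
    where
      All-mapAll : ∀ {ys} (pys : All P ys) → All (R _) ys → All (S (f _ px)) (mapAll pys)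
      All-mapAll [] [] = []
      All-mapAll (py ∷ pys) (r ∷ rs) = f-pres _ _ px py r ∷ All-mapAll pys rs

≤-foldr-⊔ : ∀ {x xs} → x ∈ xs → x ≤ foldr _⊔_ 0 xs
≤-foldr-⊔ (here refl) = m≤m⊔n _ _
≤-foldr-⊔ (there x∈xs) = ≤-trans (≤-foldr-⊔ x∈xs) (m≤n⊔m _ _)

foldr-⊔-attained : ∀ {c} xs → 0 < c → c ≤ foldr _⊔_ 0 xs → Any (c ≤_) xs
foldr-⊔-attained [] 0<c c≤0 = ⊥-elim (<⇒≱ 0<c c≤0)
foldr-⊔-attained (x ∷ xs) 0<c c≤max with ⊔-sel x (foldr _⊔_ 0 xs)
... | inj₁ max≡x = here (subst (_ ≤_) max≡x c≤max)
... | inj₂ max≡rest = there (foldr-⊔-attained xs 0<c (subst (_ ≤_) max≡rest c≤max))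

∣x∷p∣ : ∀ {n} x (p : Subset n) → ∣ x ∷ p ∣ ≡ (if x then 1 else 0) + ∣ p ∣
∣x∷p∣ true p = refl
∣x∷p∣ false p = refl

∣tabulate∣ : ∀ {n} (f : Fin n → Bool) → ∣ tabulate f ∣ ≡ sum (λ i → if f i then 1 else 0)
∣tabulate∣ {zero} f = refl
∣tabulate∣ {suc n} f = trans (∣x∷p∣ f₀ (tabulate (f ∘ Fin.suc))) (cong (χ₀ +_) (∣tabulate∣ (f ∘ Fin.suc)))
  where
    f₀ : Bool
    f₀ = f Fin.zero
    χ₀ : ℕ
    χ₀ = if f₀ then 1 else 0

preimage : ∀ {n} → Permutation′ n → Subset n → Subset n
preimage π p = tabulate (λ i → lookup p (π ⟨$⟩ʳ i))

lookup-preimage : ∀ {n} (π : Permutation′ n) p i → lookup (preimage π p) i ≡ lookup p (π ⟨$⟩ʳ i)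
lookup-preimage π p = lookup∘tabulate _

∣preimage∣ : ∀ {n} (π : Permutation′ n) p → ∣ preimage π p ∣ ≡ ∣ p ∣
∣preimage∣ π p = begin
    ∣ preimage π p ∣                ≡⟨ ∣tabulate∣ (lookup p ∘ (π ⟨$⟩ʳ_)) ⟩
    sum (indicator ∘ (π ⟨$⟩ʳ_))    ≡⟨ sum-permute indicator π ⟨
    sum indicator                   ≡⟨ ∣tabulate∣ (lookup p) ⟨
    ∣ tabulate (lookup p) ∣         ≡⟨ cong ∣_∣ (tabulate∘lookup p) ⟩
    ∣ p ∣                           ∎
  where
    open ≡-Reasoning
    indicator : Fin _ → ℕ
    indicator i = if lookup p i then 1 else 0

subsetsOfSize : (n k : ℕ) → List (Subset n)
subsetsOfSize zero zero = [ [] ]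
subsetsOfSize zero (suc k) = []
subsetsOfSize (suc n) zero = map (outside ∷_) (subsetsOfSize n zero)
subsetsOfSize (suc n) (suc k) =
  map (outside ∷_) (subsetsOfSize n (suc k)) ++ map (inside ∷_) (subsetsOfSize n k)

length-subsetsOfSize : ∀ n k → length (subsetsOfSize n k) ≡ n C k
length-subsetsOfSize zero zero = refl
length-subsetsOfSize zero (suc k) = refl
length-subsetsOfSize (suc n) zero =
  trans (length-map _ (subsetsOfSize n zero)) (length-subsetsOfSize n zero)
length-subsetsOfSize (suc n) (suc k) = begin
    length (map (outside ∷_) (subsetsOfSize n (suc k)) ++ map (inside ∷_) (subsetsOfSize n k))
      ≡⟨ length-++ (map (outside ∷_) (subsetsOfSize n (suc k))) ⟩
    length (map (outside ∷_) (subsetsOfSize n (suc k))) + length (map (inside ∷_) (subsetsOfSize n k))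
      ≡⟨ cong₂ _+_ (length-map _ (subsetsOfSize n (suc k))) (length-map _ (subsetsOfSize n k)) ⟩
    length (subsetsOfSize n (suc k)) + length (subsetsOfSize n k)
      ≡⟨ cong₂ _+_ (length-subsetsOfSize n (suc k)) (length-subsetsOfSize n k) ⟩
    n C suc k + n C k
      ≡⟨ +-comm (n C suc k) (n C k) ⟩
    n C k + n C suc k
      ≡⟨ nCk+nC[k+1]≡[n+1]C[k+1] n k ⟩
    suc n C suc k
      ∎
  where open ≡-Reasoning

∈-subsetsOfSize : ∀ {n} k (p : Subset n) → ∣ p ∣ ≡ k → p ∈ subsetsOfSize n k
∈-subsetsOfSize zero [] refl = here refl
∈-subsetsOfSize zero (outside ∷ p) ∣p∣≡0 = ∈-map⁺ (outside ∷_) (∈-subsetsOfSize zero p ∣p∣≡0)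
∈-subsetsOfSize (suc k) (outside ∷ p) ∣p∣≡k =
  ∈-++⁺ˡ (∈-map⁺ (outside ∷_) (∈-subsetsOfSize (suc k) p ∣p∣≡k))
∈-subsetsOfSize {suc n} (suc k) (inside ∷ p) ∣p∣≡k =
  ∈-++⁺ʳ (map (outside ∷_) (subsetsOfSize n (suc k)))
         (∈-map⁺ (inside ∷_) (∈-subsetsOfSize k p (suc-injective ∣p∣≡k)))

displacement : ∀ {n} → Permutation′ n → Permutation′ n → Fin n → ℕ
displacement σ π i = ∣ toℕ (σ ⟨$⟩ʳ i) - toℕ (π ⟨$⟩ʳ i) ∣

displacement≤chebyshev : ∀ {n} (σ π : Permutation′ n) i → displacement σ π i ≤ chebyshev σ π
displacement≤chebyshev σ π i = ≤-foldr-⊔ (∈-map⁺ (displacement σ π) (∈-allFin i))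

chebyshev-attained : ∀ {n c} (σ π : Permutation′ n) → 0 < c → c ≤ chebyshev σ π →
                     ∃ λ i → c ≤ displacement σ π i
chebyshev-attained {n} σ π 0<c c≤dist =
  satisfied (Any.map⁻ (foldr-⊔-attained (map (displacement σ π) (allFin n)) 0<c c≤dist))

separated : ∀ {n d} (σ π : Permutation′ n) → 0 < d → d ≤ chebyshev σ π → Separated d σ π
separated {d = d} σ π 0<d d≤dist = σ≢π , d≤dist
  where
    σ≢π : ¬ (∀ i → σ ⟨$⟩ʳ i ≡ π ⟨$⟩ʳ i)
    σ≢π σ≗π with i , d≤dᵢ ← chebyshev-attained σ π 0<d d≤dist = <⇒≱ 0<d (begin
        d                                        ≤⟨ d≤dᵢ ⟩
        displacement σ π i                       ≡⟨ cong (λ j → ∣ toℕ j - toℕ (π ⟨$⟩ʳ i) ∣) (σ≗π i) ⟩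
        ∣ toℕ (π ⟨$⟩ʳ i) - toℕ (π ⟨$⟩ʳ i) ∣      ≡⟨ ∣n-n∣≡0 (toℕ (π ⟨$⟩ʳ i)) ⟩
        0                                        ∎)
      where open ≤-Reasoning

∣⊥++p∣≡∣p∣ : ∀ m {n} (p : Subset n) → ∣ ⊥ {m} ++ᵛ p ∣ ≡ ∣ p ∣
∣⊥++p∣≡∣p∣ zero p = refl
∣⊥++p∣≡∣p∣ (suc m) p = ∣⊥++p∣≡∣p∣ m p

module UpperBlock (m k : ℕ) where

  upper : Subset (m + k)
  upper = ⊥ {m} ++ᵛ ⊤ {k}

  ∣upper∣ : ∣ upper ∣ ≡ k
  ∣upper∣ = trans (∣⊥++p∣≡∣p∣ m (⊤ {k})) (∣⊤∣≡n k)

  lookup-upper-↑ˡ : ∀ i → lookup upper (i ↑ˡ k) ≡ outside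
  lookup-upper-↑ˡ i = trans (lookup-++ˡ (⊥ {m}) (⊤ {k}) i) (lookup-replicate i outside)

  lookup-upper-↑ʳ : ∀ i → lookup upper (m ↑ʳ i) ≡ inside
  lookup-upper-↑ʳ i = trans (lookup-++ʳ (⊥ {m}) (⊤ {k}) i) (lookup-replicate i inside)

  lower-or-upper : ∀ j → (∃ λ i → i ↑ˡ k ≡ j) ⊎ (∃ λ i → m ↑ʳ i ≡ j)
  lower-or-upper j with splitAt m j in eq
  ... | inj₁ i = inj₁ (i , splitAt⁻¹-↑ˡ eq)
  ... | inj₂ i = inj₂ (i , splitAt⁻¹-↑ʳ eq)

  outside⇒lower : ∀ {j} → lookup upper j ≡ outside → ∃ λ i → i ↑ˡ k ≡ j
  outside⇒lower {j} j∉upper with lower-or-upper j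
  ... | inj₁ lower = lower
  ... | inj₂ (i , refl) with () ← trans (sym (lookup-upper-↑ʳ i)) j∉upper

  inside⇒upper : ∀ {j} → lookup upper j ≡ inside → ∃ λ i → m ↑ʳ i ≡ j
  inside⇒upper {j} j∈upper with lower-or-upper j
  ... | inj₂ upper = upper
  ... | inj₁ (i , refl) with () ← trans (sym (lookup-upper-↑ˡ i)) j∈upper

  ↑ʳ-distance : ∀ (a b : Fin k) → ∣ toℕ (m ↑ʳ a) - toℕ (m ↑ʳ b) ∣ < k
  ↑ʳ-distance a b = begin-strict
      ∣ toℕ (m ↑ʳ a) - toℕ (m ↑ʳ b) ∣    ≡⟨ cong₂ ∣_-_∣ (toℕ-↑ʳ m a) (toℕ-↑ʳ m b) ⟩
      ∣ m + toℕ a - m + toℕ b ∣          ≡⟨ ∣m+n-m+o∣≡∣n-o∣ m (toℕ a) (toℕ b) ⟩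
      ∣ toℕ a - toℕ b ∣                  ≤⟨ ∣m-n∣≤m⊔n (toℕ a) (toℕ b) ⟩
      toℕ a ⊔ toℕ b                      <⟨ ⊔-lub (toℕ<n a) (toℕ<n b) ⟩
      k                                  ∎
    where open ≤-Reasoning

  Stabilises : Permutation′ (m + k) → Set
  Stabilises π = ∀ j → lookup upper (π ⟨$⟩ʳ j) ≡ lookup upper j

  flip-stabilises : ∀ π → Stabilises π → Stabilises (flip π)
  flip-stabilises π π-stab j = begin
      lookup upper (π ⟨$⟩ˡ j)                ≡⟨ π-stab (π ⟨$⟩ˡ j) ⟨
      lookup upper (π ⟨$⟩ʳ (π ⟨$⟩ˡ j))       ≡⟨ cong (lookup upper) (inverseʳ π) ⟩
      lookup upper j                         ∎
    where open ≡-Reasoning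

  restrictMap : ∀ π → Stabilises π → Fin m → Fin m
  restrictMap π π-stab i = proj₁ (outside⇒lower (trans (π-stab (i ↑ˡ k)) (lookup-upper-↑ˡ i)))

  restrictMap-↑ˡ : ∀ π π-stab i → restrictMap π π-stab i ↑ˡ k ≡ π ⟨$⟩ʳ (i ↑ˡ k)
  restrictMap-↑ˡ π π-stab i = proj₂ (outside⇒lower (trans (π-stab (i ↑ˡ k)) (lookup-upper-↑ˡ i)))

  restrictMap-inverse : ∀ π π-stab π′ π′-stab → (∀ j → π′ ⟨$⟩ʳ (π ⟨$⟩ʳ j) ≡ j) →
                        ∀ i → restrictMap π′ π′-stab (restrictMap π π-stab i) ≡ i
  restrictMap-inverse π π-stab π′ π′-stab π′∘π≗id i = ↑ˡ-injective k _ i (begin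
      restrictMap π′ π′-stab (restrictMap π π-stab i) ↑ˡ k  ≡⟨ restrictMap-↑ˡ π′ π′-stab _ ⟩
      π′ ⟨$⟩ʳ (restrictMap π π-stab i ↑ˡ k)                 ≡⟨ cong (π′ ⟨$⟩ʳ_) (restrictMap-↑ˡ π π-stab i) ⟩
      π′ ⟨$⟩ʳ (π ⟨$⟩ʳ (i ↑ˡ k))                            ≡⟨ π′∘π≗id (i ↑ˡ k) ⟩
      i ↑ˡ k                                               ∎)
    where open ≡-Reasoning

  restrict : ∀ π → Stabilises π → Permutation′ m
  restrict π π-stab = permutation (restrictMap π π-stab) (restrictMap (flip π) π⁻¹-stab)
    (restrictMap-inverse (flip π) π⁻¹-stab π π-stab (λ _ → inverseʳ π))
    (restrictMap-inverse π π-stab (flip π) π⁻¹-stab (λ _ → inverseˡ π))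
    where
      π⁻¹-stab : Stabilises (flip π)
      π⁻¹-stab = flip-stabilises π π-stab

  upperPositions : Permutation′ (m + k) → Subset (m + k)
  upperPositions σ = preimage σ upper

  ∣upperPositions∣ : ∀ σ → ∣ upperPositions σ ∣ ≡ k
  ∣upperPositions∣ σ = trans (∣preimage∣ σ upper) ∣upper∣

  _∼_ : Permutation′ (m + k) → Permutation′ (m + k) → Set
  σ ∼ ρ = upperPositions σ ≡ upperPositions ρ

  same-upperPositions : ∀ σ ρ → σ ∼ ρ → ∀ i → lookup upper (σ ⟨$⟩ʳ i) ≡ lookup upper (ρ ⟨$⟩ʳ i)
  same-upperPositions σ ρ σ∼ρ i = begin
      lookup upper (σ ⟨$⟩ʳ i)          ≡⟨ lookup-preimage σ upper i ⟨
      lookup (upperPositions σ) i      ≡⟨ cong (λ v → lookup v i) σ∼ρ ⟩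
      lookup (upperPositions ρ) i      ≡⟨ lookup-preimage ρ upper i ⟩
      lookup upper (ρ ⟨$⟩ʳ i)          ∎
    where open ≡-Reasoning

  quotient-stabilises : ∀ σ ρ → σ ∼ ρ → Stabilises (flip ρ ∘ₚ σ)
  quotient-stabilises σ ρ σ∼ρ j = begin
      lookup upper (σ ⟨$⟩ʳ (ρ ⟨$⟩ˡ j))    ≡⟨ same-upperPositions σ ρ σ∼ρ (ρ ⟨$⟩ˡ j) ⟩
      lookup upper (ρ ⟨$⟩ʳ (ρ ⟨$⟩ˡ j))    ≡⟨ cong (lookup upper) (inverseʳ ρ) ⟩
      lookup upper j                      ∎
    where open ≡-Reasoning

  reduce : ∀ ρ σ → σ ∼ ρ → Permutation′ m
  reduce ρ σ σ∼ρ = restrict (flip ρ ∘ₚ σ) (quotient-stabilises σ ρ σ∼ρ)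

  toℕ-reduce : ∀ ρ σ σ∼ρ {i a} → ρ ⟨$⟩ʳ i ≡ a ↑ˡ k →
               toℕ (reduce ρ σ σ∼ρ ⟨$⟩ʳ a) ≡ toℕ (σ ⟨$⟩ʳ i)
  toℕ-reduce ρ σ σ∼ρ {i} {a} ρi≡a = begin
      toℕ (reduce ρ σ σ∼ρ ⟨$⟩ʳ a)          ≡⟨ toℕ-↑ˡ _ k ⟨
      toℕ (reduce ρ σ σ∼ρ ⟨$⟩ʳ a ↑ˡ k)     ≡⟨ cong toℕ (restrictMap-↑ˡ (flip ρ ∘ₚ σ) (quotient-stabilises σ ρ σ∼ρ) a) ⟩
      toℕ (σ ⟨$⟩ʳ (ρ ⟨$⟩ˡ (a ↑ˡ k)))       ≡⟨ cong (λ j → toℕ (σ ⟨$⟩ʳ (ρ ⟨$⟩ˡ j))) ρi≡a ⟨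
      toℕ (σ ⟨$⟩ʳ (ρ ⟨$⟩ˡ (ρ ⟨$⟩ʳ i)))     ≡⟨ cong (λ j → toℕ (σ ⟨$⟩ʳ j)) (inverseˡ ρ) ⟩
      toℕ (σ ⟨$⟩ʳ i)                       ∎
    where open ≡-Reasoning

  displacement-reduce : ∀ ρ σ₁ σ₂ σ₁∼ρ σ₂∼ρ {i a} → ρ ⟨$⟩ʳ i ≡ a ↑ˡ k →
    displacement (reduce ρ σ₁ σ₁∼ρ) (reduce ρ σ₂ σ₂∼ρ) a ≡ displacement σ₁ σ₂ i
  displacement-reduce ρ σ₁ σ₂ σ₁∼ρ σ₂∼ρ ρi≡a =
    cong₂ ∣_-_∣ (toℕ-reduce ρ σ₁ σ₁∼ρ ρi≡a) (toℕ-reduce ρ σ₂ σ₂∼ρ ρi≡a)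

  ∼-↑ʳ : ∀ σ ρ → σ ∼ ρ → ∀ {i b} → ρ ⟨$⟩ʳ i ≡ m ↑ʳ b → ∃ λ a → m ↑ʳ a ≡ σ ⟨$⟩ʳ i
  ∼-↑ʳ σ ρ σ∼ρ {i} {b} ρi≡b = inside⇒upper (begin
      lookup upper (σ ⟨$⟩ʳ i)    ≡⟨ same-upperPositions σ ρ σ∼ρ i ⟩
      lookup upper (ρ ⟨$⟩ʳ i)    ≡⟨ cong (lookup upper) ρi≡b ⟩
      lookup upper (m ↑ʳ b)      ≡⟨ lookup-upper-↑ʳ b ⟩
      inside                     ∎)
    where open ≡-Reasoning

  displacement-upper : ∀ ρ σ₁ σ₂ → σ₁ ∼ ρ → σ₂ ∼ ρ →
                       ∀ {i b} → ρ ⟨$⟩ʳ i ≡ m ↑ʳ b → displacement σ₁ σ₂ i < k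
  displacement-upper ρ σ₁ σ₂ σ₁∼ρ σ₂∼ρ ρi≡b
    with a₁ , a₁↑≡σ₁i ← ∼-↑ʳ σ₁ ρ σ₁∼ρ ρi≡b | a₂ , a₂↑≡σ₂i ← ∼-↑ʳ σ₂ ρ σ₂∼ρ ρi≡b =
      subst₂ (λ j₁ j₂ → ∣ toℕ j₁ - toℕ j₂ ∣ < k) a₁↑≡σ₁i a₂↑≡σ₂i (↑ʳ-distance a₁ a₂)

  reduce-chebyshev : ∀ {d} → 0 < d → k ≤ d → ∀ ρ σ₁ σ₂ (σ₁∼ρ : σ₁ ∼ ρ) (σ₂∼ρ : σ₂ ∼ ρ) →
                     d ≤ chebyshev σ₁ σ₂ → d ≤ chebyshev (reduce ρ σ₁ σ₁∼ρ) (reduce ρ σ₂ σ₂∼ρ)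
  reduce-chebyshev {d} 0<d k≤d ρ σ₁ σ₂ σ₁∼ρ σ₂∼ρ d≤dist
    with i , d≤dᵢ ← chebyshev-attained σ₁ σ₂ 0<d d≤dist
    with lower-or-upper (ρ ⟨$⟩ʳ i)
  ... | inj₁ (a , a↑≡ρi) = begin
      d                             ≤⟨ d≤dᵢ ⟩
      displacement σ₁ σ₂ i          ≡⟨ displacement-reduce ρ σ₁ σ₂ σ₁∼ρ σ₂∼ρ (sym a↑≡ρi) ⟨
      displacement τ₁ τ₂ a          ≤⟨ displacement≤chebyshev τ₁ τ₂ a ⟩
      chebyshev τ₁ τ₂               ∎
    where
      open ≤-Reasoning
      τ₁ τ₂ : Permutation′ m
      τ₁ = reduce ρ σ₁ σ₁∼ρ
      τ₂ = reduce ρ σ₂ σ₂∼ρ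
  ... | inj₂ (b , b↑≡ρi) =
    ⊥-elim (<⇒≱ (<-≤-trans (displacement-upper ρ σ₁ σ₂ σ₁∼ρ σ₂∼ρ (sym b↑≡ρi)) k≤d) d≤dᵢ)

module _ {m k d : ℕ} (0<d : 0 < d) (k≤d : k ≤ d) where
  open UpperBlock m k

  class-length-≤ : ∀ {q} → IsP m d q → ∀ s (D : List (Permutation′ (m + k))) →
                   IsCode (m + k) d D → All (λ σ → upperPositions σ ≡ s) D → length D ≤ q
  class-length-≤ _ s [] _ _ = z≤n
  class-length-≤ {q} (_ , maximal) s D@(ρ ∷ _) D-code D∼s@(ρ∼s ∷ _) = begin
      length D                          ≡⟨ length-mapAll reduceByρ D∼s ⟨
      length (mapAll reduceByρ D∼s)     ≤⟨ maximal _ reduced-code ⟩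
      q                                 ∎
    where
      open ≤-Reasoning
      reduceByρ : ∀ σ → upperPositions σ ≡ s → Permutation′ m
      reduceByρ σ σ∼s = reduce ρ σ (trans σ∼s (sym ρ∼s))
      reduce-separated : ∀ σ₁ σ₂ (σ₁∼s : upperPositions σ₁ ≡ s) (σ₂∼s : upperPositions σ₂ ≡ s) →
                         Separated d σ₁ σ₂ → Separated d (reduceByρ σ₁ σ₁∼s) (reduceByρ σ₂ σ₂∼s)
      reduce-separated σ₁ σ₂ σ₁∼s σ₂∼s (_ , d≤dist) =
        separated (reduceByρ σ₁ σ₁∼s) (reduceByρ σ₂ σ₂∼s) 0<d
          (reduce-chebyshev 0<d k≤d ρ σ₁ σ₂ (trans σ₁∼s (sym ρ∼s)) (trans σ₂∼s (sym ρ∼s)) d≤dist)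
      reduced-code : IsCode m d (mapAll reduceByρ D∼s)
      reduced-code = AllPairs-mapAll reduceByρ reduce-separated D∼s D-code

  P-bound : ∀ {p q} → IsP m d q → IsP (m + k) d p → p ≤ q * ((m + k) C k)
  P-bound {q = q} P[m] ((code , code-ok , refl) , _) = begin
      length code              ≤⟨ length-≤-fibres upperPositions _≟ₛ_ k-subsets code keys fibres ⟩
      length k-subsets * q     ≡⟨ cong (_* q) (length-subsetsOfSize (m + k) k) ⟩
      ((m + k) C k) * q        ≡⟨ *-comm ((m + k) C k) q ⟩
      q * ((m + k) C k)        ∎
    where
      open ≤-Reasoning
      _≟ₛ_ : DecidableEquality (Subset (m + k))
      _≟ₛ_ = ≡-dec Data.Bool._≟_
      k-subsets : List (Subset (m + k))
      k-subsets = subsetsOfSize (m + k) k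
      keys : All (λ σ → upperPositions σ ∈ k-subsets) code
      keys = All.tabulate (λ {σ} _ → ∈-subsetsOfSize k (upperPositions σ) (∣upperPositions∣ σ))
      fibres : ∀ s → length (fibre upperPositions _≟ₛ_ s code) ≤ q
      fibres s = class-length-≤ P[m] s _ (AllPairs.filter⁺ _ code-ok) (All.all-filter _ code)

theorem12 : (n d k : ℕ) → 1 ≤ k → k ≤ d → d < n →
    (p q : ℕ) → IsP n d p → IsP (n ∸ k) d q → p ≤ q * (n C k)
theorem12 n d k 1≤k k≤d d<n p q P[n] P[n∸k] =
  subst (λ N → IsP N d p → p ≤ q * (N C k)) (m∸n+n≡m k≤n)
        (P-bound {n ∸ k} {k} 0<d k≤d P[n∸k]) P[n]
  where
    0<d : 0 < d
    0<d = ≤-trans 1≤k k≤d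
    k≤n : k ≤ n
    k≤n = ≤-trans k≤d (<⇒≤ d<n)
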